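{- Let $A$ be an exponential nwqo, $n\in\mathbb{N}$, and $x\in A$ with $|x|_A<n$. Then there exists $\alpha'\in\partial_n\, o(A)$ such that $A/x\hookrightarrow C(\alpha')$.
   Context: A normed wqo (nwqo) is a wqo $(A,\leq_A)$ with a proper norm $|\cdot|_A:A\to\mathbb{N}$ (finitely many elements of norm $<n$ for each $n$). Basic nwqos: $\Gamma_p=\{a_1,\ldots,a_p\}$, letters pairwise incomparable, norm $0$. Constructions: disjoint sum $A+B$ (elements $\langle i,x\rangle$, comparable only within the same summand, norm of $x$); product $A\times B$ (componentwise order, norm = max of component norms); Kleene star $A^*$ (finite lists, $(x_1\ldots x_n)\leq(y_1\ldots y_m)$ iff $x_j\leq y_{i_j}$ for some $1\leq i_1<\cdots<i_n\leq m$, norm $\max(n,|x_1|,\ldots,|x_n|)$). An exponential nwqo is built from the $\Gamma_p$ by $+$, $\times$, and star applied only to the $\Gamma_p$'s. The residual $A/x$ is the substructure of $A$ (induced order and norm) on $\{y\in A: x\not\leq_A y\}$. A reflection $h:A\hookrightarrow B$ is a map with $h(x)\leq_B h(y)\Rightarrow x\leq_A y$ and $|h(x)|_B\leq|x|_A$; $A\hookrightarrow B$ means one exists. Ordinals are in Cantor normal form (CNF) below $\omega^{\omega^\omega}$; $\oplus,\otimes$ are natural sum and product. $o$: $o(\Gamma_p)=p$, $o(\Gamma_0^*)=1$, $o(\Gamma_{p+1}^*)=\omega^{\omega^p}$, $o(A+B)=o(A)\oplus o(B)$, $o(A\times B)=o(A)\otimes o(B)$. Conversely, for $\alpha=\omega^{\beta_1}+\cdots+\omega^{\beta_m}$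 with $\beta_i=\omega^{p_{i,1}}+\cdots+\omega^{p_{i,k_i}}$ ($p_{i,j}<\omega$), $C(\alpha)=\sum_{i=1}^m\prod_{j=1}^{k_i}\Gamma_{p_{i,j}+1}^*$ (empty sum $=\Gamma_0$, empty product $=\Gamma_1$). Derivatives, for $n>0$: $D_n(\omega^{\omega^p})=n-1$ if $p=0$ and $=\omega^{\omega^{p-1}\cdot(n-1)}\cdot(n-1)$ if $p>0$; $D_n(\omega^{\omega^{p_1}+\cdots+\omega^{p_k}})=\bigoplus_{j=1}^k\bigl(D_n(\omega^{\omega^{p_j}})\otimes\bigotimes_{\ell\neq j}\omega^{\omega^{p_\ell}}\bigr)$ (so $D_n(1)=0$); and $\partial_n(\sum_{i=1}^m\omega^{\beta_i})=\{D_n(\omega^{\beta_i})\oplus\bigoplus_{\ell\neq i}\omega^{\beta_\ell}: i=1,\ldots,m\}$. -}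

module Defs where

open import Data.Nat using (ℕ; zero; suc; _≤_; _⊔_; _∸_; _≤ᵇ_; _<ᵇ_; _≡ᵇ_)
open import Data.Bool using (Bool; true; false; if_then_else_)
open import Data.Fin using (Fin)
open import Data.List using (List; []; _∷_; _++_; length; replicate; map; concatMap; foldr)
open import Data.List.Relation.Binary.Sublist.Heterogeneous using (Sublist)
open import Data.Sum using (_⊎_; inj₁; inj₂)
open import Data.Product using (Σ; Σ-syntax; _×_; _,_; proj₁)
open import Data.Empty using (⊥)
open import Relation.Nullary using (¬_)
open import Relation.Binary.PropositionalEquality using (_≡_)

record NWQO : Set₁ where
  field
    Carrier : Set
    _≼_     : Carrier → Carrier → Set
    norm    : Carrier → ℕ
open NWQO public

residual : (A : NWQO) → Carrier A → NWQO
residual A x = record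
  { Carrier = Σ[ y ∈ Carrier A ] ¬ (_≼_ A x y)
  ; _≼_     = λ y z → _≼_ A (proj₁ y) (proj₁ z)
  ; norm    = λ y → norm A (proj₁ y)
  }

record Reflection (A B : NWQO) : Set where
  field
    h       : Carrier A → Carrier B
    reflect : ∀ x y → _≼_ B (h x) (h y) → _≼_ A x y
    normDec : ∀ x → norm B (h x) ≤ norm A x

_↪_ : NWQO → NWQO → Set
A ↪ B = Reflection A B

data Exp : Set where
  Γ    : ℕ → Exp
  Γ*   : ℕ → Exp
  _⊞_  : Exp → Exp → Exp
  _⊠_  : Exp → Exp → Exp

El : Exp → Set
El (Γ p)   = Fin p
El (Γ* p)  = List (Fin p)
El (A ⊞ B) = El A ⊎ El B
El (A ⊠ B) = El A × El B

Leq : (A : Exp) → El A → El A → Set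
Leq (Γ p)   a b = a ≡ b
Leq (Γ* p)  u v = Sublist _≡_ u v
Leq (A ⊞ B) (inj₁ a) (inj₁ b) = Leq A a b
Leq (A ⊞ B) (inj₁ a) (inj₂ b) = ⊥
Leq (A ⊞ B) (inj₂ a) (inj₁ b) = ⊥
Leq (A ⊞ B) (inj₂ a) (inj₂ b) = Leq B a b
Leq (A ⊠ B) (a , b) (a' , b') = Leq A a a' × Leq B b b'

Norm : (A : Exp) → El A → ℕ
Norm (Γ p)   a = 0
Norm (Γ* p)  u = length u     -- max(n, |x_1|,...,|x_n|) with letter norms 0
Norm (A ⊞ B) (inj₁ a) = Norm A a
Norm (A ⊞ B) (inj₂ b) = Norm B b
Norm (A ⊠ B) (a , b)  = Norm A a ⊔ Norm B b

⟦_⟧ : Exp → NWQO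
⟦ A ⟧ = record { Carrier = El A ; _≼_ = Leq A ; norm = Norm A }

-- Ordinals below ω^(ω^ω) in Cantor normal form.
-- An exponent β < ω^ω is the list [p₁,…,p_k] (p₁ ≥ … ≥ p_k) standing for
-- ω^p₁ + … + ω^p_k; an ordinal is the list [β₁,…,β_m] (β₁ ≥ … ≥ β_m)
-- standing for ω^β₁ + … + ω^β_m.  All operations below return the
-- canonical (sorted) representation.

Exponent : Set
Exponent = List ℕ

Ord : Set
Ord = List Exponent

insertBy : {A : Set} → (A → A → Bool) → A → List A → List A
insertBy ge x [] = x ∷ []
insertBy ge x (y ∷ ys) = if ge x y then x ∷ y ∷ ys else y ∷ insertBy ge x ys

sortBy : {A : Set} → (A → A → Bool) → List A → List A
sortBy ge = foldr (insertBy ge) []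

geℕ : ℕ → ℕ → Bool
geℕ m n = n ≤ᵇ m

geExp : Exponent → Exponent → Bool
geExp [] [] = true
geExp [] (_ ∷ _) = false
geExp (_ ∷ _) [] = true
geExp (a ∷ as) (b ∷ bs) = if a ≡ᵇ b then geExp as bs else b <ᵇ a

_⊕ᵉ_ : Exponent → Exponent → Exponent
β ⊕ᵉ γ = sortBy geℕ (β ++ γ)

_⊕_ : Ord → Ord → Ord
α ⊕ α' = sortBy geExp (α ++ α')

_⊗_ : Ord → Ord → Ord
α ⊗ α' = sortBy geExp (concatMap (λ β → map (λ γ → β ⊕ᵉ γ) α') α)

fin : ℕ → Ord
fin k = replicate k []

ωωp : ℕ → Ord
ωωp p = (p ∷ []) ∷ []

⨁ : List Ord → Ord
⨁ = foldr _⊕_ []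

⨂ : List Ord → Ord
⨂ = foldr _⊗_ (fin 1)

picks : {A : Set} → List A → List (A × List A)
picks [] = []
picks (x ∷ xs) = (x , xs) ∷ map (λ { (y , ys) → (y , x ∷ ys) }) (picks xs)

o : Exp → Ord
o (Γ p)        = fin p
o (Γ* zero)    = fin 1
o (Γ* (suc p)) = ωωp p
o (A ⊞ B)      = o A ⊕ o B
o (A ⊠ B)      = o A ⊗ o B

sumE : List Exp → Exp
sumE [] = Γ 0
sumE (A ∷ []) = A
sumE (A ∷ B ∷ As) = A ⊞ sumE (B ∷ As)

prodE : List Exp → Exp
prodE [] = Γ 1
prodE (A ∷ []) = A
prodE (A ∷ B ∷ As) = A ⊠ prodE (B ∷ As)

C : Ord → Exp
C α = sumE (map (λ β → prodE (map (λ p → Γ* (suc p)) β)) α)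

-- Derivatives (used for n > 0)

Dωωp : ℕ → ℕ → Ord
Dωωp n zero    = fin (n ∸ 1)
Dωωp n (suc q) = replicate (n ∸ 1) (replicate (n ∸ 1) q)   -- ω^(ω^q·(n-1))·(n-1)

Dω : ℕ → Exponent → Ord
Dω n β = ⨁ (map (λ { (p , rest) → Dωωp n p ⊗ (rest ∷ []) }) (picks β))

∂ : ℕ → Ord → List Ord
∂ n α = map (λ { (β , rest) → Dω n β ⊕ rest }) (picks α)

module Submission where

-- Every exponential nwqo A reflects into a normal form  Poly (o A): a disjoint
-- sum, one summand per term ω^β of the Cantor normal form of o(A), of
-- "monomials"  Mono β = Γ*_{p₁+1} × … × Γ*_{p_k+1}  (β = ω^p₁+…+ω^p_k).
-- This is built from a small calculus of reflections (functoriality of + and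
-- ×, associativity, commutativity, units, distributivity, invariance under
-- permutation of summands/factors), which also shows Poly α ↪ C α.
-- Residuals transport along reflections, so it suffices to bound the residual
-- of Poly α at an element z of norm < n.  That residual is computed summand by
-- summand: inside a product a ⋠ y means "some coordinate fails", and inside
-- Γ*_{p+1} a word y avoiding w = c w' as a subword either misses the letter c
-- (a word over p letters) or splits as y = u c v with c ∉ u and w' ⋠ v.
-- Iterating, the residual of Γ*_{p+1} at w reflects into Poly (D_n(ω^{ω^p}))
-- when |w| < n; collecting the cases gives Poly (D_n(ω^β) ⊕ rest), one of the
-- ordinals of ∂_n o(A).

open import Defs
open import Data.Nat using (ℕ; zero; suc; _<_; _≤_; _⊔_; _∸_; z≤n; s≤s)
open import Data.Nat.Properties
  using (≤-refl; ≤-trans; ≤-reflexive; ≤-<-trans; ⊔-lub; m≤m⊔n; m≤n⊔m; ⊔-mono-≤; ⊔-assoc; ⊔-comm; ⊔-identityʳ; n≤1+n; m≤n⇒m≤1+n)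
open import Data.Fin using (Fin; zero; suc; punchOut; _≟_)
open import Data.Fin.Properties using (punchOut-injective)
open import Data.List using (List; []; _∷_; _++_; length; replicate; map; concatMap)
open import Data.List.Relation.Unary.All using (All; []; _∷_)
open import Data.List.Relation.Unary.Any using (here; there)
open import Data.List.Membership.Propositional using (_∈_)
open import Data.List.Membership.Propositional.Properties using (∈-map⁺)
open import Data.List.Relation.Binary.Sublist.Heterogeneous using (Sublist; []; _∷_; _∷ʳ_; minimum)
open import Data.List.Relation.Binary.Sublist.Heterogeneous.Properties using (++⁺; ++ˡ; sublist?)
open import Data.List.Relation.Binary.Permutation.Propositional using (_↭_; refl; prep; swap; trans)
open import Data.Product using (Σ-syntax; _×_; _,_; proj₁)
open import Data.Sum using (_⊎_; inj₁; inj₂)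
open import Data.Bool using (Bool; true; false)
open import Data.Empty using (⊥-elim)
open import Relation.Nullary using (¬_; Dec; yes; no)
open import Relation.Binary.PropositionalEquality using (_≡_; _≢_; refl; sym; cong; subst; subst₂)
open Relation.Binary.PropositionalEquality.≡-Reasoning

open Reflection

infixr 9 _∘R_

_⇒_ : Exp → Exp → Set
A ⇒ B = ⟦ A ⟧ ↪ ⟦ B ⟧

idR : {A : NWQO} → A ↪ A
idR = record { h = λ x → x ; reflect = λ _ _ le → le ; normDec = λ _ → ≤-refl }

_∘R_ : {A B D : NWQO} → B ↪ D → A ↪ B → A ↪ D
g ∘R f = record { h = λ x → h g (h f x)
                ; reflect = λ x y le → reflect f x y (reflect g _ _ le)
                ; normDec = λ x → ≤-trans (normDec g (h f x)) (normDec f x) }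

fromEmpty : {X Y : NWQO} → ¬ Carrier X → X ↪ Y
fromEmpty e = record { h = λ x → ⊥-elim (e x) ; reflect = λ x _ _ → ⊥-elim (e x)
                     ; normDec = λ x → ⊥-elim (e x) }

-- A reflection e maps  X / x  into  Y / e(x): if x ⋠ y then e(x) ⋠ e(y).
transport : {X Y : NWQO} (e : X ↪ Y) (x : Carrier X) → residual X x ↪ residual Y (h e x)
transport e x = record { h = λ { (y , x⋠y) → h e y , (λ le → x⋠y (reflect e x y le)) }
                       ; reflect = λ { (y , _) (y' , _) le → reflect e y y' le }
                       ; normDec = λ { (y , _) → normDec e y } }

inj₁R : {A B : Exp} → A ⇒ (A ⊞ B)
inj₁R = record { h = inj₁ ; reflect = λ _ _ le → le ; normDec = λ _ → ≤-refl }

inj₂R : {A B : Exp} → B ⇒ (A ⊞ B)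
inj₂R = record { h = inj₂ ; reflect = λ _ _ le → le ; normDec = λ _ → ≤-refl }

copair : {A B : Exp} {T : NWQO} (f : ⟦ A ⟧ ↪ T) (g : ⟦ B ⟧ ↪ T) →
  (∀ a b → ¬ _≼_ T (h f a) (h g b)) → (∀ b a → ¬ _≼_ T (h g b) (h f a)) → ⟦ A ⊞ B ⟧ ↪ T
copair {A} {B} {T} f g f⋠g g⋠f = record { h = hh ; reflect = rr ; normDec = nn }
  where
  hh : El (A ⊞ B) → Carrier T
  hh (inj₁ a) = h f a
  hh (inj₂ b) = h g b
  rr : ∀ x y → _≼_ T (hh x) (hh y) → Leq (A ⊞ B) x y
  rr (inj₁ a) (inj₁ a') le = reflect f a a' le
  rr (inj₁ a) (inj₂ b)  le = f⋠g a b le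
  rr (inj₂ b) (inj₁ a)  le = g⋠f b a le
  rr (inj₂ b) (inj₂ b') le = reflect g b b' le
  nn : ∀ x → norm T (hh x) ≤ Norm (A ⊞ B) x
  nn (inj₁ a) = normDec f a
  nn (inj₂ b) = normDec g b

⊞-map : {A A' B B' : Exp} → A ⇒ A' → B ⇒ B' → (A ⊞ B) ⇒ (A' ⊞ B')
⊞-map f g = copair (inj₁R ∘R f) (inj₂R ∘R g) (λ _ _ ()) (λ _ _ ())

⊞-comm : {A B : Exp} → (A ⊞ B) ⇒ (B ⊞ A)
⊞-comm = copair inj₂R inj₁R (λ _ _ ()) (λ _ _ ())

⊞-assoc : {A B D : Exp} → ((A ⊞ B) ⊞ D) ⇒ (A ⊞ (B ⊞ D))
⊞-assoc = copair (copair inj₁R (inj₂R ∘R inj₁R) (λ _ _ ()) (λ _ _ ())) (inj₂R ∘R inj₂R)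
                 (λ { (inj₁ _) _ () ; (inj₂ _) _ () }) (λ { _ (inj₁ _) () ; _ (inj₂ _) () })

⊞-swap : {A B D : Exp} → (A ⊞ (B ⊞ D)) ⇒ (B ⊞ (A ⊞ D))
⊞-swap = copair (inj₂R ∘R inj₁R) (copair inj₁R (inj₂R ∘R inj₂R) (λ _ _ ()) (λ _ _ ()))
                (λ { _ (inj₁ _) () ; _ (inj₂ _) () }) (λ { (inj₁ _) _ () ; (inj₂ _) _ () })

⊞-unitˡ : {A : Exp} → (Γ 0 ⊞ A) ⇒ A
⊞-unitˡ = copair (fromEmpty (λ ())) idR (λ ()) (λ _ ())

⊞-unitʳ : {A : Exp} → (A ⊞ Γ 0) ⇒ A
⊞-unitʳ = copair idR (fromEmpty (λ ())) (λ _ ()) (λ ())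

Γ₁-single : (a b : Fin 1) → a ≡ b
Γ₁-single zero zero = refl

Γ*₀-single : (u v : List (Fin 0)) → Sublist _≡_ u v
Γ*₀-single [] [] = []
Γ*₀-single [] (() ∷ _)
Γ*₀-single (() ∷ _) _

⊠-map : {A A' B B' : Exp} → A ⇒ A' → B ⇒ B' → (A ⊠ B) ⇒ (A' ⊠ B')
⊠-map f g = record { h = λ { (a , b) → h f a , h g b }
                   ; reflect = λ { (a , b) (a' , b') (p , q) → reflect f a a' p , reflect g b b' q }
                   ; normDec = λ { (a , b) → ⊔-mono-≤ (normDec f a) (normDec g b) } }

⊠-comm : {A B : Exp} → (A ⊠ B) ⇒ (B ⊠ A)
⊠-comm {A} {B} = record { h = λ { (a , b) → b , a } ; reflect = λ { _ _ (q , p) → p , q }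
                        ; normDec = λ { (a , b) → ≤-reflexive (⊔-comm (Norm B b) (Norm A a)) } }

⊠-assoc : {A B D : Exp} → ((A ⊠ B) ⊠ D) ⇒ (A ⊠ (B ⊠ D))
⊠-assoc {A} {B} {D} =
  record { h = λ { ((a , b) , d) → a , (b , d) } ; reflect = λ { _ _ (p , (q , r)) → (p , q) , r }
         ; normDec = λ { ((a , b) , d) → ≤-reflexive (sym (⊔-assoc (Norm A a) (Norm B b) (Norm D d))) } }

⊠-swap : {A B D : Exp} → (A ⊠ (B ⊠ D)) ⇒ (B ⊠ (A ⊠ D))
⊠-swap {A} {B} {D} =
  record { h = λ { (a , (b , d)) → b , (a , d) } ; reflect = λ { _ _ (q , (p , r)) → p , (q , r) }
         ; normDec = λ { (a , (b , d)) → ≤-reflexive (⊔-left-comm (Norm B b) (Norm A a) (Norm D d)) } }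
  where
  ⊔-left-comm : ∀ x y z → x ⊔ (y ⊔ z) ≡ y ⊔ (x ⊔ z)
  ⊔-left-comm x y z = begin
    x ⊔ (y ⊔ z)  ≡⟨ sym (⊔-assoc x y z) ⟩
    (x ⊔ y) ⊔ z  ≡⟨ cong (_⊔ z) (⊔-comm x y) ⟩
    (y ⊔ x) ⊔ z  ≡⟨ ⊔-assoc y x z ⟩
    y ⊔ (x ⊔ z)  ∎

⊠-unitʳ : {A : Exp} → (A ⊠ Γ 1) ⇒ A
⊠-unitʳ {A} = record { h = proj₁ ; reflect = λ { (a , u) (b , u') le → le , Γ₁-single u u' }
                     ; normDec = λ { (a , u) → m≤m⊔n (Norm A a) 0 } }

⊠-unitˡ : {A : Exp} → (Γ 1 ⊠ A) ⇒ A
⊠-unitˡ = ⊠-unitʳ ∘R ⊠-comm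

⊠-zeroʳ : {A : Exp} → (A ⊠ Γ 0) ⇒ Γ 0
⊠-zeroʳ = fromEmpty (λ { (_ , ()) })

⊠-zeroˡ : {A : Exp} → (Γ 0 ⊠ A) ⇒ Γ 0
⊠-zeroˡ = fromEmpty (λ { (() , _) })

distˡ : {A B D : Exp} → (A ⊠ (B ⊞ D)) ⇒ ((A ⊠ B) ⊞ (A ⊠ D))
distˡ {A} {B} {D} = record { h = hh ; reflect = rr ; normDec = nn }
  where
  hh : El (A ⊠ (B ⊞ D)) → El ((A ⊠ B) ⊞ (A ⊠ D))
  hh (a , inj₁ b) = inj₁ (a , b)
  hh (a , inj₂ d) = inj₂ (a , d)
  rr : ∀ x y → Leq ((A ⊠ B) ⊞ (A ⊠ D)) (hh x) (hh y) → Leq (A ⊠ (B ⊞ D)) x y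
  rr (a , inj₁ b) (a' , inj₁ b') le = le
  rr (a , inj₂ d) (a' , inj₂ d') le = le
  rr (a , inj₁ b) (a' , inj₂ d') ()
  rr (a , inj₂ d) (a' , inj₁ b') ()
  nn : ∀ x → Norm ((A ⊠ B) ⊞ (A ⊠ D)) (hh x) ≤ Norm (A ⊠ (B ⊞ D)) x
  nn (a , inj₁ b) = ≤-refl
  nn (a , inj₂ d) = ≤-refl

distʳ : {A B D : Exp} → ((A ⊞ B) ⊠ D) ⇒ ((A ⊠ D) ⊞ (B ⊠ D))
distʳ = ⊞-map ⊠-comm ⊠-comm ∘R distˡ ∘R ⊠-comm

-- The monomial ω^β, β = ω^p₁+…+ω^p_k, is realised by Γ*_{p₁+1} × … × Γ*_{p_k+1} × Γ_1,
-- and an ordinal ω^β₁+…+ω^β_m by Mono β₁ + … + Mono β_m + Γ_0.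
Mono : Exponent → Exp
Mono [] = Γ 1
Mono (p ∷ β) = Γ* (suc p) ⊠ Mono β

Poly : Ord → Exp
Poly [] = Γ 0
Poly (β ∷ α) = Mono β ⊞ Poly α

Mono-perm : {β β' : Exponent} → β ↭ β' → Mono β ⇒ Mono β'
Mono-perm refl = idR
Mono-perm (prep _ π) = ⊠-map idR (Mono-perm π)
Mono-perm (swap _ _ π) = ⊠-swap ∘R ⊠-map idR (⊠-map idR (Mono-perm π))
Mono-perm (trans π π') = Mono-perm π' ∘R Mono-perm π

Poly-perm : {α α' : Ord} → α ↭ α' → Poly α ⇒ Poly α'
Poly-perm refl = idR
Poly-perm (prep _ π) = ⊞-map idR (Poly-perm π)
Poly-perm (swap _ _ π) = ⊞-swap ∘R ⊞-map idR (⊞-map idR (Poly-perm π))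
Poly-perm (trans π π') = Poly-perm π' ∘R Poly-perm π

insertBy-↭ : {X : Set} (ge : X → X → Bool) (x : X) (ys : List X) → (x ∷ ys) ↭ insertBy ge x ys
insertBy-↭ ge x [] = refl
insertBy-↭ ge x (y ∷ ys) with ge x y
... | true  = refl
... | false = trans (swap x y refl) (prep y (insertBy-↭ ge x ys))

sortBy-↭ : {X : Set} (ge : X → X → Bool) (xs : List X) → xs ↭ sortBy ge xs
sortBy-↭ ge [] = refl
sortBy-↭ ge (x ∷ xs) = trans (prep x (sortBy-↭ ge xs)) (insertBy-↭ ge x (sortBy ge xs))

Mono-++ : (β β' : Exponent) → (Mono β ⊠ Mono β') ⇒ Mono (β ++ β')
Mono-++ [] β' = ⊠-unitˡ
Mono-++ (p ∷ β) β' = ⊠-map idR (Mono-++ β β') ∘R ⊠-assoc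

Poly-++ : (α α' : Ord) → (Poly α ⊞ Poly α') ⇒ Poly (α ++ α')
Poly-++ [] α' = ⊞-unitˡ
Poly-++ (β ∷ α) α' = ⊞-map idR (Poly-++ α α') ∘R ⊞-assoc

Mono-⊕ᵉ : (β β' : Exponent) → (Mono β ⊠ Mono β') ⇒ Mono (β ⊕ᵉ β')
Mono-⊕ᵉ β β' = Mono-perm (sortBy-↭ geℕ (β ++ β')) ∘R Mono-++ β β'

Poly-⊕ : (α α' : Ord) → (Poly α ⊞ Poly α') ⇒ Poly (α ⊕ α')
Poly-⊕ α α' = Poly-perm (sortBy-↭ geExp (α ++ α')) ∘R Poly-++ α α'

Mono⊠Poly : (β : Exponent) (α : Ord) → (Mono β ⊠ Poly α) ⇒ Poly (map (β ⊕ᵉ_) α)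
Mono⊠Poly β [] = ⊠-zeroʳ
Mono⊠Poly β (γ ∷ α) = ⊞-map (Mono-⊕ᵉ β γ) (Mono⊠Poly β α) ∘R distˡ

Poly⊠Poly : (α α' : Ord) → (Poly α ⊠ Poly α') ⇒ Poly (concatMap (λ β → map (β ⊕ᵉ_) α') α)
Poly⊠Poly [] α' = ⊠-zeroˡ
Poly⊠Poly (β ∷ α) α' = Poly-++ (map (β ⊕ᵉ_) α') _ ∘R ⊞-map (Mono⊠Poly β α') (Poly⊠Poly α α') ∘R distʳ

Poly-⊗ : (α α' : Ord) → (Poly α ⊠ Poly α') ⇒ Poly (α ⊗ α')
Poly-⊗ α α' = Poly-perm (sortBy-↭ geExp _) ∘R Poly⊠Poly α α'

-- Poly α is C α up to the trailing units Γ_1 and Γ_0.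
Mono-prodE : (β : Exponent) → Mono β ⇒ prodE (map (λ p → Γ* (suc p)) β)
Mono-prodE [] = idR
Mono-prodE (p ∷ []) = ⊠-unitʳ
Mono-prodE (p ∷ q ∷ β) = ⊠-map idR (Mono-prodE (q ∷ β))

Poly-C : (α : Ord) → Poly α ⇒ C α
Poly-C [] = idR
Poly-C (β ∷ []) = Mono-prodE β ∘R ⊞-unitʳ
Poly-C (β ∷ β' ∷ α) = ⊞-map (Mono-prodE β) (Poly-C (β' ∷ α))

-- The finite ordinal p: Γ_p is a sum of p copies of Γ_1.
Γ-Poly : (p : ℕ) → Γ p ⇒ Poly (fin p)
Γ-Poly zero = idR
Γ-Poly (suc p) = record { h = hh ; reflect = rr ; normDec = nn }
  where
  hh : Fin (suc p) → El (Poly (fin (suc p)))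
  hh zero = inj₁ zero
  hh (suc i) = inj₂ (h (Γ-Poly p) i)
  rr : ∀ x y → Leq (Poly (fin (suc p))) (hh x) (hh y) → x ≡ y
  rr zero zero _ = refl
  rr (suc x) (suc y) le = cong suc (reflect (Γ-Poly p) x y le)
  nn : ∀ x → Norm (Poly (fin (suc p))) (hh x) ≤ 0
  nn zero = z≤n
  nn (suc i) = normDec (Γ-Poly p) i

toPoly : (A : Exp) → A ⇒ Poly (o A)
toPoly (Γ p) = Γ-Poly p
toPoly (Γ* zero) = record { h = λ _ → inj₁ zero ; reflect = λ u v _ → Γ*₀-single u v ; normDec = λ _ → z≤n }
toPoly (Γ* (suc p)) = record { h = λ w → inj₁ (w , zero) ; reflect = λ _ _ le → proj₁ le
                             ; normDec = λ w → ⊔-lub ≤-refl z≤n }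
toPoly (A ⊞ B) = Poly-⊕ (o A) (o B) ∘R ⊞-map (toPoly A) (toPoly B)
toPoly (A ⊠ B) = Poly-⊗ (o A) (o B) ∘R ⊠-map (toPoly A) (toPoly B)

residual-inj₁ : {A B A' : Exp} (a : El A) → residual ⟦ A ⟧ a ↪ ⟦ A' ⟧ →
  residual ⟦ A ⊞ B ⟧ (inj₁ a) ↪ ⟦ A' ⊞ B ⟧
residual-inj₁ {A} {B} {A'} a f = record { h = hh ; reflect = rr ; normDec = nn }
  where
  X = residual ⟦ A ⊞ B ⟧ (inj₁ a)
  hh : Carrier X → El (A' ⊞ B)
  hh (inj₁ u , a⋠u) = inj₁ (h f (u , a⋠u))
  hh (inj₂ v , _) = inj₂ v
  rr : ∀ x y → Leq (A' ⊞ B) (hh x) (hh y) → _≼_ X x y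
  rr (inj₁ u , a⋠u) (inj₁ u' , a⋠u') le = reflect f (u , a⋠u) (u' , a⋠u') le
  rr (inj₂ v , _) (inj₂ v' , _) le = le
  nn : ∀ x → Norm (A' ⊞ B) (hh x) ≤ norm X x
  nn (inj₁ u , a⋠u) = normDec f (u , a⋠u)
  nn (inj₂ v , _) = ≤-refl

residual-inj₂ : {A B B' : Exp} (b : El B) → residual ⟦ B ⟧ b ↪ ⟦ B' ⟧ →
  residual ⟦ A ⊞ B ⟧ (inj₂ b) ↪ ⟦ A ⊞ B' ⟧
residual-inj₂ b f = ⊞-comm ∘R residual-inj₁ b f ∘R transport ⊞-comm (inj₂ b)

-- Residual of a product:  (a,b) ⋠ (u,v)  iff  a ⋠ u  or  b ⋠ v, hence
-- (A × B)/(a,b) ↪ (A/a × B) + (A × B/b).  Deciding a ≤ u selects the summand.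
residual-⊠ : {A B A' B' : Exp} {a : El A} {b : El B} → (∀ u → Dec (Leq A a u)) →
  residual ⟦ A ⟧ a ↪ ⟦ A' ⟧ → residual ⟦ B ⟧ b ↪ ⟦ B' ⟧ →
  residual ⟦ A ⊠ B ⟧ (a , b) ↪ ⟦ (A' ⊠ B) ⊞ (A ⊠ B') ⟧
residual-⊠ {A} {B} {A'} {B'} {a} {b} a≤? f g =
  record { h = λ { ((u , v) , ab⋠uv) → hh u v ab⋠uv (a≤? u) }
         ; reflect = λ { ((u , v) , ab⋠uv) ((u' , v') , ab⋠uv') le → rr u v ab⋠uv (a≤? u) u' v' ab⋠uv' (a≤? u') le }
         ; normDec = λ { ((u , v) , ab⋠uv) → nn u v ab⋠uv (a≤? u) } }
  where
  T = (A' ⊠ B) ⊞ (A ⊠ B')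
  hh : ∀ u v → ¬ Leq (A ⊠ B) (a , b) (u , v) → Dec (Leq A a u) → El T
  hh u v ab⋠uv (no a⋠u) = inj₁ (h f (u , a⋠u) , v)
  hh u v ab⋠uv (yes a≤u) = inj₂ (u , h g (v , λ b≤v → ab⋠uv (a≤u , b≤v)))
  rr : ∀ u v n d u' v' n' d' → Leq T (hh u v n d) (hh u' v' n' d') → Leq (A ⊠ B) (u , v) (u' , v')
  rr u v n (no a⋠u) u' v' n' (no a⋠u') (le₁ , le₂) = reflect f (u , a⋠u) (u' , a⋠u') le₁ , le₂
  rr u v n (yes _) u' v' n' (yes _) (le₁ , le₂) = le₁ , reflect g (v , _) (v' , _) le₂
  nn : ∀ u v n d → Norm T (hh u v n d) ≤ Norm A u ⊔ Norm B v
  nn u v n (no a⋠u) = ⊔-mono-≤ (normDec f (u , a⋠u)) ≤-refl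
  nn u v n (yes _) = ⊔-mono-≤ ≤-refl (normDec g (v , _))

ResWord : ℕ → ℕ → Exp
ResWord p zero = Γ 0
ResWord p (suc k) = Γ* p ⊞ (Γ* p ⊠ ResWord p k)

-- A word over p+1 letters avoiding the letter c is a word over p letters.
punchAll : {p : ℕ} (c : Fin (suc p)) (u : List (Fin (suc p))) → All (c ≢_) u → List (Fin p)
punchAll c [] [] = []
punchAll c (a ∷ u) (c≢a ∷ c∉u) = punchOut c≢a ∷ punchAll c u c∉u

punchAll-length : {p : ℕ} (c : Fin (suc p)) (u : List (Fin (suc p))) (c∉u : All (c ≢_) u) → length (punchAll c u c∉u) ≡ length u
punchAll-length c [] [] = refl
punchAll-length c (a ∷ u) (_ ∷ c∉u) = cong suc (punchAll-length c u c∉u)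

punchAll-reflect : {p : ℕ} (c : Fin (suc p)) (u : List (Fin (suc p))) (c∉u : All (c ≢_) u)
  (u' : List (Fin (suc p))) (c∉u' : All (c ≢_) u') →
  Sublist _≡_ (punchAll c u c∉u) (punchAll c u' c∉u') → Sublist _≡_ u u'
punchAll-reflect c [] [] [] [] [] = []
punchAll-reflect c (a ∷ u) (_ ∷ _) [] [] ()
punchAll-reflect c u c∉u (b ∷ u') (_ ∷ c∉u') (_ ∷ʳ s) = b ∷ʳ punchAll-reflect c u c∉u u' c∉u' s
punchAll-reflect c (a ∷ u) (c≢a ∷ c∉u) (b ∷ u') (c≢b ∷ c∉u') (e ∷ s) =
  punchOut-injective c≢a c≢b e ∷ punchAll-reflect c u c∉u u' c∉u' s

FirstOccurrence : {p : ℕ} → Fin (suc p) → List (Fin (suc p)) → Set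
FirstOccurrence c y = All (c ≢_) y ⊎ Σ[ u ∈ _ ] Σ[ v ∈ _ ] (All (c ≢_) u × y ≡ u ++ c ∷ v)

firstOccurrence : {p : ℕ} (c : Fin (suc p)) (y : List (Fin (suc p))) → FirstOccurrence c y
firstOccurrence c [] = inj₁ []
firstOccurrence c (a ∷ y) with c ≟ a
... | yes refl = inj₂ ([] , y , [] , refl)
... | no c≢a with firstOccurrence c y
...   | inj₁ c∉y = inj₁ (c≢a ∷ c∉y)
...   | inj₂ (u , v , c∉u , refl) = inj₂ (a ∷ u , v , c≢a ∷ c∉u , refl)

length-++-left : {X : Set} (u : List X) (x : X) (v : List X) → length u ≤ length (u ++ x ∷ v)
length-++-left [] x v = z≤n
length-++-left (a ∷ u) x v = s≤s (length-++-left u x v)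

length-++-right : {X : Set} (u : List X) (x : X) (v : List X) → length v ≤ length (u ++ x ∷ v)
length-++-right [] x v = n≤1+n _
length-++-right (a ∷ u) x v = m≤n⇒m≤1+n (length-++-right u x v)

-- One letter more: a word y with  c w' ⋠ y  either avoids c, or is u c v with
-- c ∉ u and w' ⋠ v; the first case lands in Γ*_p, the second in Γ*_p × (Γ*_{p+1}/w').
residual-cons : {p k : ℕ} (c : Fin (suc p)) (w' : List (Fin (suc p))) →
  residual ⟦ Γ* (suc p) ⟧ w' ↪ ⟦ ResWord p k ⟧ → residual ⟦ Γ* (suc p) ⟧ (c ∷ w') ↪ ⟦ ResWord p (suc k) ⟧
residual-cons {p} {k} c w' r =
  record { h = λ { (y , cw'⋠y) → hh y cw'⋠y (firstOccurrence c y) }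
         ; reflect = λ { (y , n) (y' , n') le → rr y n (firstOccurrence c y) y' n' (firstOccurrence c y') le }
         ; normDec = λ { (y , n) → nn y n (firstOccurrence c y) } }
  where
  T = ResWord p (suc k)
  w'⋠tail : ∀ y u v → ¬ Sublist _≡_ (c ∷ w') y → y ≡ u ++ c ∷ v → ¬ Sublist _≡_ w' v
  w'⋠tail y u v cw'⋠y y≡ucv w'≤v = cw'⋠y (subst (Sublist _≡_ (c ∷ w')) (sym y≡ucv) (++ˡ u (refl ∷ w'≤v)))
  hh : ∀ y → ¬ Sublist _≡_ (c ∷ w') y → FirstOccurrence c y → El T
  hh y _ (inj₁ c∉y) = inj₁ (punchAll c y c∉y)
  hh y n (inj₂ (u , v , c∉u , eq)) = inj₂ (punchAll c u c∉u , h r (v , w'⋠tail y u v n eq))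
  rr : ∀ y n o y' n' o' → Leq T (hh y n o) (hh y' n' o') → Sublist _≡_ y y'
  rr y _ (inj₁ c∉y) y' _ (inj₁ c∉y') le = punchAll-reflect c y c∉y y' c∉y' le
  rr y _ (inj₂ (u , v , c∉u , eq)) y' _ (inj₂ (u' , v' , c∉u' , eq')) (le₁ , le₂) =
    subst₂ (Sublist _≡_) (sym eq) (sym eq')
      (++⁺ (punchAll-reflect c u c∉u u' c∉u' le₁) (refl ∷ reflect r (v , _) (v' , _) le₂))
  nn : ∀ y n o → Norm T (hh y n o) ≤ length y
  nn y _ (inj₁ c∉y) = ≤-reflexive (punchAll-length c y c∉y)
  nn y n (inj₂ (u , v , c∉u , refl)) =
    ⊔-lub (≤-trans (≤-reflexive (punchAll-length c u c∉u)) (length-++-left u c v))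
          (≤-trans (normDec r (v , _)) (length-++-right u c v))

-- Residual of Γ*_{p+1} at w, by induction on w (nothing avoids the empty word).
residual-Γ* : {p : ℕ} (w : List (Fin (suc p))) → residual ⟦ Γ* (suc p) ⟧ w ↪ ⟦ ResWord p (length w) ⟧
residual-Γ* [] = fromEmpty (λ { (y , []⋠y) → []⋠y (minimum y) })
residual-Γ* (c ∷ w') = residual-cons c w' (residual-Γ* w')

Γ*₀-Γ₁ : Γ* 0 ⇒ Γ 1
Γ*₀-Γ₁ = record { h = λ _ → zero ; reflect = λ u v _ → Γ*₀-single u v ; normDec = λ _ → z≤n }

⊠-unitʳ⁻¹ : {A : Exp} → A ⇒ (A ⊠ Γ 1)
⊠-unitʳ⁻¹ {A} = record { h = λ a → a , zero ; reflect = λ _ _ → proj₁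
                      ; normDec = λ a → ≤-reflexive (⊔-identityʳ (Norm A a)) }

bottom : (β : Exponent) → El (Mono β)
bottom [] = zero
bottom (p ∷ β) = [] , bottom β

bottom-norm : (β : Exponent) → Norm (Mono β) (bottom β) ≡ 0
bottom-norm [] = refl
bottom-norm (p ∷ β) = bottom-norm β

Γ₁-Mono : (β : Exponent) → Γ 1 ⇒ Mono β
Γ₁-Mono β = record { h = λ _ → bottom β ; reflect = λ u v _ → Γ₁-single u v
                   ; normDec = λ _ → ≤-reflexive (bottom-norm β) }

-- Padding: ω^{ω^q·k}·k grows with k, both in the monomial and in the multiplicity.
Mono-replicate-≤ : (q : ℕ) {k m : ℕ} → k ≤ m → Mono (replicate k q) ⇒ Mono (replicate m q)
Mono-replicate-≤ q {m = m} z≤n = Γ₁-Mono (replicate m q)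
Mono-replicate-≤ q (s≤s k≤m) = ⊠-map idR (Mono-replicate-≤ q k≤m)

Poly-replicate-≤ : (β : Exponent) {k m : ℕ} → k ≤ m → Poly (replicate k β) ⇒ Poly (replicate m β)
Poly-replicate-≤ β z≤n = fromEmpty (λ ())
Poly-replicate-≤ β (s≤s k≤m) = ⊞-map idR (Poly-replicate-≤ β k≤m)

Poly-replicate-map : {β β' : Exponent} (k : ℕ) → Mono β ⇒ Mono β' → Poly (replicate k β) ⇒ Poly (replicate k β')
Poly-replicate-map zero f = idR
Poly-replicate-map (suc k) f = ⊞-map f (Poly-replicate-map k f)

Γ*⊠Poly-replicate : (q : ℕ) (β : Exponent) (k : ℕ) →
  (Γ* (suc q) ⊠ Poly (replicate k β)) ⇒ Poly (replicate k (q ∷ β))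
Γ*⊠Poly-replicate q β zero = ⊠-zeroʳ
Γ*⊠Poly-replicate q β (suc k) = ⊞-map idR (Γ*⊠Poly-replicate q β k) ∘R distˡ

-- ResWord p k is bounded by D_{k+1}(ω^{ω^p}):  k  for p = 0,
-- and  ω^{ω^q·k}·k  for p = q+1.
ResWord₀-Poly : (k : ℕ) → ResWord 0 k ⇒ Poly (replicate k [])
ResWord₀-Poly zero = idR
ResWord₀-Poly (suc k) = ⊞-map Γ*₀-Γ₁ (ResWord₀-Poly k ∘R ⊠-unitˡ ∘R ⊠-map Γ*₀-Γ₁ idR)

ResWord-Poly : (q k : ℕ) → ResWord (suc q) k ⇒ Poly (replicate k (replicate k q))
ResWord-Poly q zero = idR
ResWord-Poly q (suc k) =
  ⊞-map (⊠-map idR (Γ₁-Mono (replicate k q)) ∘R ⊠-unitʳ⁻¹)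
        (Γ*⊠Poly-replicate q (replicate k q) k ∘R ⊠-map idR (ResWord-Poly q k))

<⇒≤∸1 : {m n : ℕ} → m < n → m ≤ n ∸ 1
<⇒≤∸1 (s≤s m≤n) = m≤n

residual-Γ*-D : (n p : ℕ) (w : List (Fin (suc p))) → length w < n →
  residual ⟦ Γ* (suc p) ⟧ w ↪ ⟦ Poly (Dωωp n p) ⟧
residual-Γ*-D n zero w |w|<n =
  Poly-replicate-≤ [] (<⇒≤∸1 |w|<n) ∘R ResWord₀-Poly (length w) ∘R residual-Γ* w
residual-Γ*-D n (suc q) w |w|<n =
  Poly-replicate-≤ _ (<⇒≤∸1 |w|<n) ∘R Poly-replicate-map (length w) (Mono-replicate-≤ q (<⇒≤∸1 |w|<n))
  ∘R ResWord-Poly q (length w) ∘R residual-Γ* w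

-- The summands D_n(ω^{ω^q}) ⊗ ω^r of D_n(ω^β), one per choice (q , r) ∈ picks β,
-- realised as a disjoint sum.
derivTerm : ℕ → ℕ × Exponent → Ord
derivTerm n (q , r) = Dωωp n q ⊗ (r ∷ [])

DerivTerms : ℕ → List (ℕ × Exponent) → Exp
DerivTerms n [] = Γ 0
DerivTerms n ((q , r) ∷ L) = (Poly (Dωωp n q) ⊠ Mono r) ⊞ DerivTerms n L

DerivTerms-Poly : (n : ℕ) (L : List (ℕ × Exponent)) → DerivTerms n L ⇒ Poly (⨁ (map (derivTerm n) L))
DerivTerms-Poly n [] = idR
DerivTerms-Poly n ((q , r) ∷ L) =
  Poly-⊕ _ _ ∘R ⊞-map (Poly-⊗ (Dωωp n q) (r ∷ []) ∘R ⊠-map idR inj₁R) (DerivTerms-Poly n L)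

addRest : ℕ → ℕ × Exponent → ℕ × Exponent
addRest p (q , r) = q , p ∷ r

Γ*⊠DerivTerms : (n p : ℕ) (L : List (ℕ × Exponent)) →
  (Γ* (suc p) ⊠ DerivTerms n L) ⇒ DerivTerms n (map (addRest p) L)
Γ*⊠DerivTerms n p [] = ⊠-zeroʳ
Γ*⊠DerivTerms n p ((q , r) ∷ L) = ⊞-map ⊠-swap (Γ*⊠DerivTerms n p L) ∘R distˡ

-- Residual of a monomial at an element of norm < n: one summand of D_n(ω^β)
-- per coordinate in which the element fails to be below.
residual-Mono : (n : ℕ) (β : Exponent) (z : El (Mono β)) → Norm (Mono β) z < n →
  residual ⟦ Mono β ⟧ z ↪ ⟦ DerivTerms n (picks β) ⟧
residual-Mono n [] z _ = fromEmpty (λ { (y , z⋠y) → z⋠y (Γ₁-single z y) })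
residual-Mono n (p ∷ β) (w , z) |wz|<n =
  ⊞-map idR (Γ*⊠DerivTerms n p (picks β))
  ∘R residual-⊠ (sublist? _≟_ w)
       (residual-Γ*-D n p w (≤-<-trans (m≤m⊔n _ _) |wz|<n))
       (residual-Mono n β z (≤-<-trans (m≤n⊔m _ _) |wz|<n))

residual-Poly : (n : ℕ) (α : Ord) (z : El (Poly α)) → Norm (Poly α) z < n →
  Σ[ β ∈ Exponent ] Σ[ rest ∈ Ord ]
    ((β , rest) ∈ picks α × (residual ⟦ Poly α ⟧ z ↪ ⟦ DerivTerms n (picks β) ⊞ Poly rest ⟧))
residual-Poly n (β ∷ α) (inj₁ z) |z|<n = β , α , here refl , residual-inj₁ z (residual-Mono n β z |z|<n)
residual-Poly n (β ∷ α) (inj₂ z) |z|<n with residual-Poly n α z |z|<n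
... | β' , rest , β'∈α , r = β' , β ∷ rest , there (∈-map⁺ _ β'∈α) , ⊞-swap ∘R residual-inj₂ z r

mainTheorem3 : (A : Exp) (n : ℕ) (x : El A) → Norm A x < n →
    Σ[ α' ∈ Ord ] (α' ∈ ∂ n (o A) × (residual ⟦ A ⟧ x ↪ ⟦ C α' ⟧))
mainTheorem3 A n x |x|<n
  with residual-Poly n (o A) (h (toPoly A) x) (≤-<-trans (normDec (toPoly A) x) |x|<n)
... | β , rest , picked , r =
  Dω n β ⊕ rest , ∈-map⁺ _ picked ,
  Poly-C _ ∘R Poly-⊕ (Dω n β) rest ∘R ⊞-map (DerivTerms-Poly n (picks β)) idR ∘R r ∘R transport (toPoly A) x
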